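{- Let $\mathcal C$ be a category, let $A$ be a zigzag of length $n\ge 0$ in $\mathcal C$, and let $0\le i\le n$. Let $A'$ be the zigzag of length $n+1$ obtained from $A$ by inserting an identity cospan at height $i$: $A'(r_k)=A(r_k)$ for $k\le i$, $A'(r_k)=A(r_{k-1})$ for $k>i$, $A'(s_k)=A(s_k)$ for $k<i$, $A'(s_i)=A(r_i)$ with both legs $A'(r_i)\to A'(s_i)\leftarrow A'(r_{i+1})$ equal to $\mathrm{id}_{A(r_i)}$, $A'(s_k)=A(s_{k-1})$ for $k>i$, all other cospan legs being those of $A$. Let $f:A\to A'$ be the zigzag map whose singular map is the face map $d_i:[n]\to[n+1]$ and all of whose regular and singular slices are identity maps. Then $f$ is $\pi$-cocartesian, where $\pi:Z(\mathcal C)\to\Delta_+$.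
   Context: For $n\ge0$, $[n]$ denotes the total order $\{0,\dots,n-1\}$; $\Delta_+$ is the category of these finite total orders and order-preserving maps. The face map $d_i:[n]\to[n+1]$ is the unique injective order-preserving map whose image omits $i$. For order-preserving $f:[n]\to[m]$ define $f^\flat:[m+1]\to[n+1]$ by $f^\flat(i)=\min(\{j\in[n]: f(j)\ge i\}\cup\{n\})$. A zigzag $X$ of length $n$ in a category $\mathcal C$ consists of regular objects $X(r_0),\dots,X(r_n)$, singular objects $X(s_0),\dots,X(s_{n-1})$ and cospans $X(r_i)\to X(s_i)\leftarrow X(r_{i+1})$ for $0\le i<n$. A zigzag map $f:X\to Y$ ($X$ of length $n$, $Y$ of length $m$) consists of an order-preserving singular map $f_s:[n]\to[m]$, with regular map $f_r:=f_s^\flat:[m+1]\to[n+1]$, regular slices $f(r_i):X(r_{f_r(i)})\to Y(r_i)$ ($0\le i\le m$) and singular slices $f(s_j):X(s_j)\to Y(s_{f_s(j)})$ ($0\le j<n$), such that for each $0\le i<m$: (a) if $f_s^{ -1}(i)$ is nonempty with least element $p$ and greatest element $q$, then $f(s_p)\circ(X(r_p)\to X(s_p))=(Y(r_i)\to Y(s_i))\circ f(r_i)$, $f(s_q)\circ(X(r_{q+1})\to X(s_q))=(Y(r_{i+1})\to Y(s_i))\circ f(r_{i+1})$, and $f(s_j)\circ(X(r_{j+1})\to X(s_j))=f(s_{j+1})\circ(X(r_{j+1})\to X(s_{j+1}))$ for $p\le j<q$; (b) if $f_s^{ -1}(i)$ is empty, then $(Y(r_i)\to Y(s_i))\circ f(r_i)=(Y(r_{i+1})\to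 Y(s_i))\circ f(r_{i+1})$. Composition is $(g\circ f)_s=g_s\circ f_s$, $(g\circ f)(s_j)=g(s_{f_s(j)})\circ f(s_j)$, $(g\circ f)(r_i)=g(r_i)\circ f(r_{g_r(i)})$; this defines the category $Z(\mathcal C)$. The functor $\pi:Z(\mathcal C)\to\Delta_+$ sends a zigzag of length $n$ to $[n]$ and $f$ to $f_s$. For a functor $p:\mathcal A\to\mathcal B$, a map $f:x\to y$ in $\mathcal A$ is $p$-cartesian if for every $h:x'\to y$ and every $u:p(x')\to p(x)$ with $p(h)=p(f)\circ u$ there is a unique $v:x'\to x$ with $f\circ v=h$ and $p(v)=u$; $f$ is $p$-cocartesian if it is $p^{\mathrm{op}}$-cartesian (i.e. for every $h:x\to y'$ and $u:p(y)\to p(y')$ with $p(h)=u\circ p(f)$ there is a unique $v:y\to y'$ with $v\circ f=h$ and $p(v)=u$). -}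

module Defs where

open import Level using (Level; _⊔_)
open import Data.Nat using (ℕ; zero; suc)
import Data.Nat.Properties as ℕP
open import Data.Fin using (Fin; zero; suc; toℕ; inject₁; pinch; punchIn; _≤_)
open import Data.Product using (Σ; _×_; _,_; ∃-syntax)
open import Relation.Nullary using (¬_; yes; no)
open import Relation.Binary.PropositionalEquality using (_≡_; _≢_; _≗_)
open import Relation.Binary.HeterogeneousEquality using (_≅_)
open import Function using () renaming (_∘_ to _∘ᶠ_)

record Category (o ℓ : Level) : Set (Level.suc (o ⊔ ℓ)) where
  infixr 9 _∘_
  field
    Obj  : Set o
    Hom  : Obj → Obj → Set ℓ
    id   : ∀ {a} → Hom a a
    _∘_  : ∀ {a b c} → Hom b c → Hom a b → Hom a c
    assoc     : ∀ {a b c d} (f : Hom a b) (g : Hom b c) (h : Hom c d) →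
                (h ∘ g) ∘ f ≡ h ∘ (g ∘ f)
    identityˡ : ∀ {a b} (f : Hom a b) → id ∘ f ≡ f
    identityʳ : ∀ {a b} (f : Hom a b) → f ∘ id ≡ f

-- Δ₊ : [n] = Fin n, morphisms are order-preserving maps
-- (two morphisms of Δ₊ are equal iff they agree pointwise)

record Δ₊Hom (n m : ℕ) : Set where
  field
    fun  : Fin n → Fin m
    mono : ∀ {a b} → a ≤ b → fun a ≤ fun b
open Δ₊Hom public

-- f♭ : [m+1] → [n+1],  f♭(i) = min ({ j ∈ [n] | f j ≥ i } ∪ {n})
flat : ∀ {n m} → (Fin n → Fin m) → Fin (suc m) → Fin (suc n)
flat {zero}  f i = zero
flat {suc n} f i with toℕ i ℕP.≤? toℕ (f zero)
... | yes _ = zero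
... | no  _ = suc (flat (f ∘ᶠ suc) i)

-- face map d_i : [n] → [n+1] (image omits i) is the library's punchIn i

module _ {o ℓ} (C : Category o ℓ) where
  open Category C

  record Zigzag (n : ℕ) : Set (o ⊔ ℓ) where
    field
      r   : Fin (suc n) → Obj
      s   : Fin n → Obj
      fwd : (k : Fin n) → Hom (r (inject₁ k)) (s k)
      bwd : (k : Fin n) → Hom (r (suc k)) (s k)

  module _ {n m : ℕ} (X : Zigzag n) (Y : Zigzag m) where
    private
      module X = Zigzag X
      module Y = Zigzag Y

    ZigzagCond : (fs : Fin n → Fin m)
                 (reg : (k : Fin (suc m)) → Hom (X.r (flat fs k)) (Y.r k))
                 (sing : (j : Fin n) → Hom (X.s j) (Y.s (fs j))) →
                 Fin m → Set ℓ
    ZigzagCond fs reg sing i =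
      -- (a) preimage nonempty, least element p, greatest element q
      (∀ (p q : Fin n) →
         (fs p ≡ i) → (∀ j → fs j ≡ i → p ≤ j) →
         (fs q ≡ i) → (∀ j → fs j ≡ i → j ≤ q) →
           ((sing p ∘ X.fwd p) ≅ (Y.fwd i ∘ reg (inject₁ i)))
         × ((sing q ∘ X.bwd q) ≅ (Y.bwd i ∘ reg (suc i)))
         × (∀ (j j' : Fin n) → p ≤ j → toℕ j' ≡ suc (toℕ j) → j' ≤ q →
              (sing j ∘ X.bwd j) ≅ (sing j' ∘ X.fwd j')))
      × ((∀ j → fs j ≢ i) →
           (Y.fwd i ∘ reg (inject₁ i)) ≅ (Y.bwd i ∘ reg (suc i)))

    record ZigzagMap : Set (o ⊔ ℓ) where
      field
        fs   : Fin n → Fin m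
        fs-mono : ∀ {a b} → a ≤ b → fs a ≤ fs b
        reg  : (k : Fin (suc m)) → Hom (X.r (flat fs k)) (Y.r k)
        sing : (j : Fin n) → Hom (X.s j) (Y.s (fs j))
        cond : ∀ (i : Fin m) → ZigzagCond fs reg sing i

  open ZigzagMap public

  π : ∀ {n m} {X : Zigzag n} {Y : Zigzag m} → ZigzagMap X Y → Δ₊Hom n m
  π f = record { fun = fs f ; mono = fs-mono f }

  _≈Z_ : ∀ {n m} {X : Zigzag n} {Y : Zigzag m} → ZigzagMap X Y → ZigzagMap X Y → Set ℓ
  f ≈Z g = (fs f ≗ fs g)
         × (∀ j → sing f j ≅ sing g j)
         × (∀ k → reg f k ≅ reg g k)

  -- "g ∘ f = h" in Z(C), with composition unfolded as in the paper:
  -- (g∘f)_s = g_s ∘ f_s, (g∘f)(s_j) = g(s_{f_s j}) ∘ f(s_j),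
  -- (g∘f)(r_k) = g(r_k) ∘ f(r_{g_r k})
  CompEq : ∀ {n m l} {X : Zigzag n} {Y : Zigzag m} {W : Zigzag l} →
           ZigzagMap Y W → ZigzagMap X Y → ZigzagMap X W → Set ℓ
  CompEq g f h = (fs g ∘′ fs f ≗ fs h)
               × (∀ j → (sing g (fs f j) ∘ sing f j) ≅ sing h j)
               × (∀ k → (reg g k ∘ reg f (flat (fs g) k)) ≅ reg h k)
    where
      _∘′_ : ∀ {A B D : Set} → (B → D) → (A → B) → A → D
      (F ∘′ G) x = F (G x)

  IsCocartesian : ∀ {n m} {X : Zigzag n} {Y : Zigzag m} → ZigzagMap X Y → Set (o ⊔ ℓ)
  IsCocartesian {n} {m} {X} {Y} f =
    ∀ {l} (Y' : Zigzag l) (h : ZigzagMap X Y') (u : Δ₊Hom m l) →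
      (fun (π h) ≗ (λ j → fun u (fun (π f) j))) →
      Σ (ZigzagMap Y Y') λ v →
          (CompEq v f h × (fun (π v) ≗ fun u))
        × (∀ (w : ZigzagMap Y Y') → CompEq w f h → (fun (π w) ≗ fun u) → w ≈Z v)

  private
    sI : ∀ {n} (r : Fin (suc n) → Obj) (s : Fin n → Obj) →
         Fin (suc n) → Fin (suc n) → Obj
    sI         r s zero    zero    = r zero
    sI         r s zero    (suc k) = s k
    sI {suc n} r s (suc i) zero    = s zero
    sI {suc n} r s (suc i) (suc k) = sI (r ∘ᶠ suc) (s ∘ᶠ suc) i k

    fwdI : ∀ {n} (r : Fin (suc n) → Obj) (s : Fin n → Obj)
           (fwd : (k : Fin n) → Hom (r (inject₁ k)) (s k)) →
           (i k : Fin (suc n)) → Hom (r (pinch i (inject₁ k))) (sI r s i k)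
    fwdI         r s fwd zero    zero    = id
    fwdI         r s fwd zero    (suc k) = fwd k
    fwdI {suc n} r s fwd (suc i) zero    = fwd zero
    fwdI {suc n} r s fwd (suc i) (suc k) = fwdI (r ∘ᶠ suc) (s ∘ᶠ suc) (fwd ∘ᶠ suc) i k

    bwdI : ∀ {n} (r : Fin (suc n) → Obj) (s : Fin n → Obj)
           (bwd : (k : Fin n) → Hom (r (suc k)) (s k)) →
           (i k : Fin (suc n)) → Hom (r (pinch i (suc k))) (sI r s i k)
    bwdI         r s bwd zero    zero    = id
    bwdI         r s bwd zero    (suc k) = bwd k
    bwdI {suc n} r s bwd (suc i) zero    = bwd zero
    bwdI {suc n} r s bwd (suc i) (suc k) = bwdI (r ∘ᶠ suc) (s ∘ᶠ suc) (bwd ∘ᶠ suc) i k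

  -- A'(r_k) = A(r_{pinch i k}) (= A(r_k) for k ≤ i, A(r_{k-1}) for k > i);
  -- A'(s_k) = A(s_k) (k < i), A(r_i) (k = i, both legs identities), A(s_{k-1}) (k > i)
  insertId : ∀ {n} → Zigzag n → Fin (suc n) → Zigzag (suc n)
  insertId A i = record
    { r   = λ k → Zigzag.r A (pinch i k)
    ; s   = sI (Zigzag.r A) (Zigzag.s A) i
    ; fwd = fwdI (Zigzag.r A) (Zigzag.s A) (Zigzag.fwd A) i
    ; bwd = bwdI (Zigzag.r A) (Zigzag.s A) (Zigzag.bwd A) i
    }

-- Given h : A → Y and u with π(h) = u ∘ d_i, the factorisation v : A′ → Y with v_s = u is forced
-- everywhere except at the inserted singular height i: the regular slices and the singular slices
-- at d_i(j) must be those of h, since f has identity slices. At i there are two cases. If the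
-- height i−1 lies in the fibre of u over u(i), the compatibility condition between heights i−1
-- and i (whose legs at i are identities) forces v(s_i) = h(s_{i−1}) ∘ (A(r_i) → A(s_{i−1})).
-- Otherwise i is the least element of its fibre and condition (a) forces
-- v(s_i) = (Y(r_{u i}) → Y(s_{u i})) ∘ v(r_{u i}). The zigzag conditions for v then reduce,
-- fibre by fibre, to those of h.
module Submission where

open import Defs
open import Level using (Level; _⊔_)
open import Data.Nat using (ℕ; zero; suc; z≤n; s≤s; s≤s⁻¹) renaming (_≤_ to _≤ℕ_; _<_ to _<ℕ_)
import Data.Nat.Properties as ℕ
open import Data.Fin using (Fin; zero; suc; toℕ; inject₁; punchIn; punchOut; pinch; _≤_; _<_)
open import Data.Fin.Properties
  using (_≟_; _≤?_; any?; ≤-antisym; ≤∧≢⇒<; toℕ-injective; toℕ-inject₁; suc-injective;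
         punchIn-cancel-≤; punchIn-punchOut; punchInᵢ≢i; punchOut-cong; punchOut-punchIn)
open import Data.Product using (∃; _×_; _,_; proj₁; proj₂)
open import Data.Empty using (⊥-elim)
open import Relation.Nullary using (¬_; Dec; yes; no)
open import Relation.Nullary.Decidable using (_×-dec_)
open import Relation.Unary using (Pred; Decidable)
open import Relation.Binary.Definitions using (Monotonic₁)
open import Relation.Binary.PropositionalEquality
  using (_≡_; _≢_; refl; sym; trans; cong; subst; _≗_)
open import Relation.Binary.HeterogeneousEquality as H using (_≅_)

module _ {n m : ℕ} (s : Fin n → Fin m) (k : Fin m) where

  MinOfFibre MaxOfFibre : Fin n → Set
  MinOfFibre j = s j ≡ k × (∀ j′ → s j′ ≡ k → j ≤ j′)
  MaxOfFibre j = s j ≡ k × (∀ j′ → s j′ ≡ k → j′ ≤ j)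

module _ {p : Level} where

  ∃-least : ∀ {n} {P : Pred (Fin n) p} → Decidable P → ∃ P →
            ∃ λ j → P j × (∀ j′ → P j′ → j ≤ j′)
  ∃-least {suc n} P? (j , Pj) with P? zero
  ∃-least {suc n} P? (j , Pj)     | yes P0 = zero , P0 , λ _ _ → z≤n
  ∃-least {suc n} P? (zero , Pj)  | no ¬P0 = ⊥-elim (¬P0 Pj)
  ∃-least {suc n} P? (suc j , Pj) | no ¬P0 with ∃-least (λ x → P? (suc x)) (j , Pj)
  ... | j₀ , Pj₀ , min =
    suc j₀ , Pj₀ , λ { zero P0 → ⊥-elim (¬P0 P0) ; (suc j′) Pj′ → s≤s (min j′ Pj′) }

  ∃-greatest : ∀ {n} {P : Pred (Fin n) p} → Decidable P → ∃ P →
               ∃ λ j → P j × (∀ j′ → P j′ → j′ ≤ j)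
  ∃-greatest {suc n} P? (j , Pj) with any? (λ x → P? (suc x))
  ... | yes witness with ∃-greatest (λ x → P? (suc x)) witness
  ...   | j₀ , Pj₀ , max = suc j₀ , Pj₀ , λ { zero _ → z≤n ; (suc j′) Pj′ → s≤s (max j′ Pj′) }
  ∃-greatest {suc n} P? (zero , Pj)  | no none =
    zero , Pj , λ { zero _ → z≤n ; (suc j′) Pj′ → ⊥-elim (none (j′ , Pj′)) }
  ∃-greatest {suc n} P? (suc j , Pj) | no none = ⊥-elim (none (j , Pj))

module _ {n m : ℕ} (s : Fin n → Fin m) {k : Fin m} {j : Fin n} where

  fibre-min : s j ≡ k → ∃ (MinOfFibre s k)
  fibre-min sj≡k = ∃-least (λ x → s x ≟ k) (j , sj≡k)

  fibre-max : s j ≡ k → ∃ (MaxOfFibre s k)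
  fibre-max sj≡k = ∃-greatest (λ x → s x ≟ k) (j , sj≡k)

module _ {n m : ℕ} {s t : Fin n → Fin m} {k : Fin m} {j : Fin n} where

  minOfFibre-resp : s ≗ t → MinOfFibre s k j → MinOfFibre t k j
  minOfFibre-resp s≗t (sj≡k , min) = trans (sym (s≗t j)) sj≡k , λ j′ e → min j′ (trans (s≗t j′) e)

  maxOfFibre-resp : s ≗ t → MaxOfFibre s k j → MaxOfFibre t k j
  maxOfFibre-resp s≗t (sj≡k , max) = trans (sym (s≗t j)) sj≡k , λ j′ e → max j′ (trans (s≗t j′) e)

module _ {n m : ℕ} {s : Fin (suc n) → Fin m} {k : Fin m} (i : Fin (suc n)) {j : Fin n} where

  minOfFibre-punchIn : MinOfFibre s k (punchIn i j) → MinOfFibre (λ x → s (punchIn i x)) k j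
  minOfFibre-punchIn (sj≡k , min) = sj≡k , λ j′ e → punchIn-cancel-≤ i j j′ (min (punchIn i j′) e)

  maxOfFibre-punchIn : MaxOfFibre s k (punchIn i j) → MaxOfFibre (λ x → s (punchIn i x)) k j
  maxOfFibre-punchIn (sj≡k , max) = sj≡k , λ j′ e → punchIn-cancel-≤ i j′ j (max (punchIn i j′) e)

minOfFibre-unless-predecessor : ∀ {n m} {s : Fin (suc n) → Fin m} → Monotonic₁ _≤_ _≤_ s →
  ∀ i → (∀ a → suc a ≡ i → s (inject₁ a) ≢ s i) → MinOfFibre s (s i) i
minOfFibre-unless-predecessor mono zero    _     = refl , λ _ _ → z≤n
minOfFibre-unless-predecessor {s = s} mono (suc a) pred∉ = refl , min
  where
    min : ∀ j → s j ≡ s (suc a) → suc a ≤ j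
    min j sj≡ with suc a ≤? j
    ... | yes 1+a≤j = 1+a≤j
    ... | no  1+a≰j =
      ⊥-elim (pred∉ a refl (≤-antisym (mono a≤1+a) (subst (_≤ s (inject₁ a)) sj≡ (mono j≤a))))
      where
        a≤1+a : inject₁ a ≤ suc a
        a≤1+a = ℕ.≤-trans (ℕ.≤-reflexive (toℕ-inject₁ a)) (ℕ.n≤1+n _)
        j≤a : j ≤ inject₁ a
        j≤a = ℕ.≤-trans (ℕ.≤-pred (ℕ.≰⇒> 1+a≰j)) (ℕ.≤-reflexive (sym (toℕ-inject₁ a)))

data PunchInView {n : ℕ} (i : Fin (suc n)) : Fin (suc n) → Set where
  pivot   : PunchInView i i
  punched : (j : Fin n) → PunchInView i (punchIn i j)

punchIn-view : ∀ {n} (i j′ : Fin (suc n)) → PunchInView i j′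
punchIn-view i j′ with i ≟ j′
... | yes refl = pivot
... | no  i≢j′ = subst (PunchInView i) (punchIn-punchOut i≢j′) (punched (punchOut i≢j′))

punchIn-suc-self : ∀ {n} (a : Fin n) → punchIn (suc a) a ≡ inject₁ a
punchIn-suc-self zero    = refl
punchIn-suc-self (suc a) = cong suc (punchIn-suc-self a)

pinch-inject₁-self : ∀ {n} (i : Fin (suc n)) → pinch i (inject₁ i) ≡ i
pinch-inject₁-self {zero}  zero    = refl
pinch-inject₁-self {suc n} zero    = refl
pinch-inject₁-self {suc n} (suc i) = cong suc (pinch-inject₁-self i)

≤-punchIn : ∀ {n} (i : Fin (suc n)) (j : Fin n) → j ≤ punchIn i j
≤-punchIn zero    j       = ℕ.n≤1+n _
≤-punchIn (suc i) zero    = z≤n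
≤-punchIn (suc i) (suc j) = s≤s (≤-punchIn i j)

punchIn≤pivot⇒< : ∀ {n} (i : Fin (suc n)) (j : Fin n) → punchIn i j ≤ i → j < i
punchIn≤pivot⇒< zero    j       ()
punchIn≤pivot⇒< (suc i) zero    _         = s≤s z≤n
punchIn≤pivot⇒< (suc i) (suc j) (s≤s le) = s≤s (punchIn≤pivot⇒< i j le)

pivot≤punchIn⇒≤ : ∀ {n} (i : Fin (suc n)) (j : Fin n) → i ≤ punchIn i j → i ≤ j
pivot≤punchIn⇒≤ zero    j       _         = z≤n
pivot≤punchIn⇒≤ (suc i) zero    ()
pivot≤punchIn⇒≤ (suc i) (suc j) (s≤s le) = s≤s (pivot≤punchIn⇒≤ i j le)

punchIn-consecutive : ∀ {n} (i : Fin (suc n)) (j j′ : Fin n) →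
  toℕ (punchIn i j′) ≡ suc (toℕ (punchIn i j)) → toℕ j′ ≡ suc (toℕ j)
punchIn-consecutive zero    j       j′       e = ℕ.suc-injective e
punchIn-consecutive (suc i) zero    zero     ()
punchIn-consecutive (suc i) zero    (suc j′) e =
  cong suc (ℕ.n≤0⇒n≡0 (ℕ.≤-trans (≤-punchIn i j′) (ℕ.≤-reflexive (ℕ.suc-injective e))))
punchIn-consecutive (suc i) (suc j) zero     ()
punchIn-consecutive (suc i) (suc j) (suc j′) e = cong suc (punchIn-consecutive i j j′ (ℕ.suc-injective e))

toℕ-just-below⇒suc≡pivot : ∀ {n} (i : Fin (suc n)) (a : Fin n) →
  toℕ i ≡ suc (toℕ (punchIn i a)) → suc a ≡ i
toℕ-just-below⇒suc≡pivot zero    a       ()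
toℕ-just-below⇒suc≡pivot (suc i) zero    e = cong suc (sym (toℕ-injective (ℕ.suc-injective e)))
toℕ-just-below⇒suc≡pivot (suc i) (suc a) e = cong suc (toℕ-just-below⇒suc≡pivot i a (ℕ.suc-injective e))

suc≡pivot⇒toℕ-just-below : ∀ {n} {i : Fin (suc n)} (a : Fin n) →
  suc a ≡ i → toℕ i ≡ suc (toℕ (punchIn i a))
suc≡pivot⇒toℕ-just-below a refl = cong suc (sym (trans (cong toℕ (punchIn-suc-self a)) (toℕ-inject₁ a)))

toℕ-just-above⇒inject₁≡pivot : ∀ {n} (i : Fin (suc n)) (b : Fin n) →
  toℕ (punchIn i b) ≡ suc (toℕ i) → inject₁ b ≡ i
toℕ-just-above⇒inject₁≡pivot zero    b       e = toℕ-injective (trans (toℕ-inject₁ b) (ℕ.suc-injective e))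
toℕ-just-above⇒inject₁≡pivot (suc i) zero    ()
toℕ-just-above⇒inject₁≡pivot (suc i) (suc b) e =
  cong suc (toℕ-just-above⇒inject₁≡pivot i b (ℕ.suc-injective e))

flat≡zero : ∀ {n m} (s : Fin (suc n) → Fin m) k → toℕ k ≤ℕ toℕ (s zero) → flat s k ≡ zero
flat≡zero s k k≤s0 with toℕ k ℕ.≤? toℕ (s zero)
... | yes _    = refl
... | no  k≰s0 = ⊥-elim (k≰s0 k≤s0)

flat≡suc : ∀ {n m} (s : Fin (suc n) → Fin m) k → ¬ toℕ k ≤ℕ toℕ (s zero) →
          flat s k ≡ suc (flat (λ j → s (suc j)) k)
flat≡suc s k k≰s0 with toℕ k ℕ.≤? toℕ (s zero)
... | yes k≤s0 = ⊥-elim (k≰s0 k≤s0)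
... | no  _    = refl

flat-cong : ∀ {n m} {s t : Fin n → Fin m} → s ≗ t → ∀ k → flat s k ≡ flat t k
flat-cong {zero}                 s≗t k = refl
flat-cong {suc n} {s = s} {t} s≗t k with toℕ k ℕ.≤? toℕ (s zero)
... | yes k≤s0 = sym (flat≡zero t k (subst (λ x → toℕ k ≤ℕ toℕ x) (s≗t zero) k≤s0))
... | no  k≰s0 = trans (cong suc (flat-cong (λ j → s≗t (suc j)) k)) (sym (flat≡suc t k k≰t0))
  where
    k≰t0 : ¬ toℕ k ≤ℕ toℕ (t zero)
    k≰t0 k≤t0 = k≰s0 (subst (λ x → toℕ k ≤ℕ toℕ x) (sym (s≗t zero)) k≤t0)

flat-characterisation : ∀ {n m} (s : Fin n → Fin m) (k : Fin (suc m)) (x : Fin (suc n)) →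
  (∀ j → j < x → s j < k) → (∀ j → toℕ j ≡ toℕ x → k ≤ s j) → flat s k ≡ x
flat-characterisation {zero}  s k zero    _     _     = refl
flat-characterisation {suc n} s k x       below above with toℕ k ℕ.≤? toℕ (s zero)
flat-characterisation {suc n} s k zero    below above | yes _    = refl
flat-characterisation {suc n} s k (suc x) below above | yes k≤s0 = ⊥-elim (ℕ.<⇒≱ (below zero (s≤s z≤n)) k≤s0)
flat-characterisation {suc n} s k zero    below above | no  k≰s0 = ⊥-elim (k≰s0 (above zero refl))
flat-characterisation {suc n} s k (suc x) below above | no  _    =
  cong suc (flat-characterisation (λ j → s (suc j)) k x (λ j j<x → below (suc j) (s≤s j<x))
                                                         (λ j e → above (suc j) (cong suc e)))

flat-id : ∀ {n} (k : Fin (suc n)) → flat (λ (j : Fin n) → j) k ≡ k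
flat-id k = flat-characterisation (λ j → j) k k (λ _ j<k → j<k) (λ _ e → ℕ.≤-reflexive (sym e))

flat-∘punchIn : ∀ {n m} (s : Fin (suc n) → Fin m) → Monotonic₁ _≤_ _≤_ s →
                ∀ i k → flat (λ j → s (punchIn i j)) k ≡ pinch i (flat s k)
flat-∘punchIn {n} s mono zero k with toℕ k ℕ.≤? toℕ (s zero)
flat-∘punchIn {zero}  s mono zero k | yes _    = refl
flat-∘punchIn {suc n} s mono zero k | yes k≤s0 =
  flat≡zero (λ j → s (suc j)) k (ℕ.≤-trans k≤s0 (mono {zero} {suc zero} z≤n))
flat-∘punchIn {n}     s mono zero k | no  _    = refl
flat-∘punchIn {suc n} s mono (suc i) k with toℕ k ℕ.≤? toℕ (s zero)
... | yes _ = refl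
... | no  _ = cong suc (flat-∘punchIn (λ j → s (suc j)) (λ le → mono (s≤s le)) i k)

flat-punchIn : ∀ {n} (i : Fin (suc n)) (k : Fin (suc (suc n))) → flat (punchIn i) k ≡ pinch i k
flat-punchIn i k = trans (flat-∘punchIn (λ j → j) (λ le → le) i k) (cong (pinch i) (flat-id k))

flat-minOfFibre : ∀ {n m} {s : Fin n → Fin m} → Monotonic₁ _≤_ _≤_ s → ∀ {k j} →
                  MinOfFibre s k j → flat s (inject₁ k) ≡ inject₁ j
flat-minOfFibre {s = s} mono {k} {j} (sj≡k , min) = flat-characterisation s (inject₁ k) (inject₁ j) below above
  where
    below : ∀ j′ → j′ < inject₁ j → s j′ < inject₁ k
    below j′ j′<j =
      subst (toℕ (s j′) <ℕ_) (sym (toℕ-inject₁ k)) (≤∧≢⇒< (subst (s j′ ≤_) sj≡k (mono j′≤j)) sj′≢k)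
      where
        j′≤j : j′ ≤ j
        j′≤j = ℕ.≤-trans (ℕ.<⇒≤ j′<j) (ℕ.≤-reflexive (toℕ-inject₁ j))

        sj′≢k : s j′ ≢ k
        sj′≢k sj′≡k = ℕ.<⇒≱ j′<j (ℕ.≤-trans (ℕ.≤-reflexive (toℕ-inject₁ j)) (min j′ sj′≡k))
    above : ∀ j′ → toℕ j′ ≡ toℕ (inject₁ j) → inject₁ k ≤ s j′
    above j′ e rewrite toℕ-injective (trans e (toℕ-inject₁ j)) | toℕ-inject₁ k | sj≡k = ℕ.≤-refl


module _ {o ℓ} (C : Category o ℓ) where
  open Category C

  -- Morphisms whose endpoints are only propositionally equal (as happens for the objects of
  -- insertId) are compared as elements of the total space of all arrows of C.
  record Arrow : Set (o ⊔ ℓ) where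
    constructor arrow
    field
      {dom cod} : Obj
      mor       : Hom dom cod

  infix 4 _≈_
  _≈_ : ∀ {a b a′ b′} → Hom a b → Hom a′ b′ → Set (o ⊔ ℓ)
  f ≈ g = arrow f ≡ arrow g

  cast : ∀ {a a′ b b′} → a ≡ a′ → b ≡ b′ → Hom a b → Hom a′ b′
  cast refl refl f = f

  cast-≈ : ∀ {a a′ b b′} (p : a ≡ a′) (q : b ≡ b′) (f : Hom a b) → cast p q f ≈ f
  cast-≈ refl refl f = refl

  ≈⇒≅ : ∀ {a b a′ b′} {f : Hom a b} {g : Hom a′ b′} → f ≈ g → f ≅ g
  ≈⇒≅ refl = H.refl

  ≅⇒≈ : ∀ {a b a′ b′} {f : Hom a b} {g : Hom a′ b′} → a ≡ a′ → b ≡ b′ → f ≅ g → f ≈ g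
  ≅⇒≈ refl refl H.refl = refl

  ∘-resp-≈ : ∀ {a b c a′ b′ c′} {g : Hom b c} {g′ : Hom b′ c′} {f : Hom a b} {f′ : Hom a′ b′} →
             g ≈ g′ → f ≈ f′ → g ∘ f ≈ g′ ∘ f′
  ∘-resp-≈ refl refl = refl

  ∘-idʳ-≈ : ∀ {a b c x} (g : Hom b c) {f : Hom a b} → f ≈ id {x} → g ∘ f ≈ g
  ∘-idʳ-≈ g refl = cong arrow (identityʳ g)

  tail : ∀ {n} → Zigzag C (suc n) → Zigzag C n
  tail A = record
    { r = λ k → Zigzag.r A (suc k) ; s = λ k → Zigzag.s A (suc k)
    ; fwd = λ k → Zigzag.fwd A (suc k) ; bwd = λ k → Zigzag.bwd A (suc k) }

  fwd-pivot : ∀ {n} (A : Zigzag C n) i → Zigzag.fwd (insertId C A i) i ≈ id {Zigzag.r A i}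
  fwd-pivot         A zero    = refl
  fwd-pivot {suc n} A (suc i) = fwd-pivot (tail A) i

  bwd-pivot : ∀ {n} (A : Zigzag C n) i → Zigzag.bwd (insertId C A i) i ≈ id {Zigzag.r A i}
  bwd-pivot         A zero    = refl
  bwd-pivot {suc n} A (suc i) = bwd-pivot (tail A) i

  fwd-punchIn : ∀ {n} (A : Zigzag C n) i j → Zigzag.fwd (insertId C A i) (punchIn i j) ≈ Zigzag.fwd A j
  fwd-punchIn         A zero    j       = refl
  fwd-punchIn {suc n} A (suc i) zero    = refl
  fwd-punchIn {suc n} A (suc i) (suc j) = fwd-punchIn (tail A) i j

  bwd-punchIn : ∀ {n} (A : Zigzag C n) i j → Zigzag.bwd (insertId C A i) (punchIn i j) ≈ Zigzag.bwd A j
  bwd-punchIn         A zero    j       = refl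
  bwd-punchIn {suc n} A (suc i) zero    = refl
  bwd-punchIn {suc n} A (suc i) (suc j) = bwd-punchIn (tail A) i j

  s-pivot : ∀ {n} (A : Zigzag C n) i → Zigzag.s (insertId C A i) i ≡ Zigzag.r A i
  s-pivot A i = cong Arrow.cod (fwd-pivot A i)

  s-punchIn : ∀ {n} (A : Zigzag C n) i j → Zigzag.s (insertId C A i) (punchIn i j) ≡ Zigzag.s A j
  s-punchIn A i j = cong Arrow.cod (fwd-punchIn A i j)

  module _ {n m} {X : Zigzag C n} {Y : Zigzag C m} where
    private
      module X = Zigzag X
      module Y = Zigzag Y

    cond-min : (g : ZigzagMap C X Y) {k : Fin m} {j : Fin n} → MinOfFibre (fs g) k j →
               sing g j ∘ X.fwd j ≅ Y.fwd k ∘ reg g (inject₁ k)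
    cond-min g {k} {j} (gj≡k , min) with fibre-max (fs g) gj≡k
    ... | q , gq≡k , max = proj₁ (proj₁ (cond g k) j q gj≡k min gq≡k max)

    cond-max : (g : ZigzagMap C X Y) {k : Fin m} {j : Fin n} → MaxOfFibre (fs g) k j →
               sing g j ∘ X.bwd j ≅ Y.bwd k ∘ reg g (suc k)
    cond-max g {k} {j} (gj≡k , max) with fibre-min (fs g) gj≡k
    ... | p , gp≡k , min = proj₁ (proj₂ (proj₁ (cond g k) p j gp≡k min gj≡k max))

    cond-step : (g : ZigzagMap C X Y) {j j′ : Fin n} → toℕ j′ ≡ suc (toℕ j) → fs g j ≡ fs g j′ →
                sing g j ∘ X.bwd j ≅ sing g j′ ∘ X.fwd j′
    cond-step g {j} {j′} j′≡1+j gj≡gj′ with fibre-min (fs g) {j = j} refl | fibre-max (fs g) {j = j} refl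
    ... | p , gp≡k , min | q , gq≡k , max =
      proj₂ (proj₂ (proj₁ (cond g (fs g j)) p q gp≡k min gq≡k max))
        j j′ (min j refl) j′≡1+j (max j′ (sym gj≡gj′))

    zigzagCond-local :
      (s : Fin n → Fin m) → Monotonic₁ _≤_ _≤_ s →
      (reg : (k : Fin (suc m)) → Hom (X.r (flat s k)) (Y.r k)) (sing : (j : Fin n) → Hom (X.s j) (Y.s (s j))) →
      (∀ {k j} → MinOfFibre s k j → sing j ∘ X.fwd j ≅ Y.fwd k ∘ reg (inject₁ k)) →
      (∀ {k j} → MaxOfFibre s k j → sing j ∘ X.bwd j ≅ Y.bwd k ∘ reg (suc k)) →
      (∀ {j j′} → toℕ j′ ≡ suc (toℕ j) → s j ≡ s j′ → sing j ∘ X.bwd j ≅ sing j′ ∘ X.fwd j′) →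
      (∀ k → (∀ j → s j ≢ k) → Y.fwd k ∘ reg (inject₁ k) ≅ Y.bwd k ∘ reg (suc k)) →
      ∀ k → ZigzagCond C X Y s reg sing k
    zigzagCond-local s mono reg sing min-cond max-cond step-cond empty-cond k =
        (λ p q sp≡k min sq≡k max →
             min-cond (sp≡k , min) , max-cond (sq≡k , max) , step-within sp≡k sq≡k)
      , empty-cond k
      where
        in-fibre : ∀ {p q x} → s p ≡ k → s q ≡ k → p ≤ x → x ≤ q → s x ≡ k
        in-fibre sp≡k sq≡k p≤x x≤q =
          ≤-antisym (subst (_ ≤_) sq≡k (mono x≤q)) (subst (_≤ _) sp≡k (mono p≤x))

        step-within : ∀ {p q} → s p ≡ k → s q ≡ k → ∀ j j′ → p ≤ j → toℕ j′ ≡ suc (toℕ j) → j′ ≤ q →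
                      sing j ∘ X.bwd j ≅ sing j′ ∘ X.fwd j′
        step-within sp≡k sq≡k j j′ p≤j j′≡1+j j′≤q =
          step-cond j′≡1+j (trans (in-fibre sp≡k sq≡k p≤j (ℕ.≤-trans j≤j′ j′≤q))
                                  (sym (in-fibre sp≡k sq≡k (ℕ.≤-trans p≤j j≤j′) j′≤q)))
          where
            j≤j′ : j ≤ j′
            j≤j′ = ℕ.≤-trans (ℕ.n≤1+n _) (ℕ.≤-reflexive (sym j′≡1+j))

  module Extension {n l} (A : Zigzag C n) (i : Fin (suc n)) {Y : Zigzag C l}
                   (h : ZigzagMap C A Y) (u : Δ₊Hom (suc n) l)
                   (h-factors : ∀ j → fs h j ≡ fun u (punchIn i j)) where
    private
      A′ : Zigzag C (suc n)
      A′ = insertId C A i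
      module A = Zigzag A
      module A′ = Zigzag A′
      module Y = Zigzag Y
      U : Fin (suc n) → Fin l
      U = fun u
    open H.≅-Reasoning

    flat-h : ∀ k → flat (fs h) k ≡ pinch i (flat U k)
    flat-h k = trans (flat-cong h-factors k) (flat-∘punchIn U (mono u) i k)

    ext-reg : (k : Fin (suc l)) → Hom (A′.r (flat U k)) (Y.r k)
    ext-reg k = cast (cong A.r (flat-h k)) refl (reg h k)

    ext-reg-≈ : ∀ k → ext-reg k ≈ reg h k
    ext-reg-≈ k = cast-≈ _ _ _

    h-minOfFibre : ∀ {k j} → MinOfFibre U k (punchIn i j) → MinOfFibre (fs h) k j
    h-minOfFibre m = minOfFibre-resp (λ j → sym (h-factors j)) (minOfFibre-punchIn i m)

    h-maxOfFibre : ∀ {k j} → MaxOfFibre U k (punchIn i j) → MaxOfFibre (fs h) k j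
    h-maxOfFibre m = maxOfFibre-resp (λ j → sym (h-factors j)) (maxOfFibre-punchIn i m)

    U-fibre : ∀ {j k} → fs h j ≡ k → U (punchIn i j) ≡ k
    U-fibre {j} hj≡k = trans (sym (h-factors j)) hj≡k

    PredecessorInFibre : Set
    PredecessorInFibre = ∃ λ a → suc a ≡ i × fs h a ≡ U i

    predecessorInFibre? : Dec PredecessorInFibre
    predecessorInFibre? = any? λ a → (suc a ≟ i) ×-dec (fs h a ≟ U i)

    no-predecessor⇒pivot-min : ¬ PredecessorInFibre → MinOfFibre U (U i) i
    no-predecessor⇒pivot-min ¬pred = minOfFibre-unless-predecessor (mono u) i λ a 1+a≡i Ua≡Ui →
      ¬pred (a , 1+a≡i , trans (h-factors a) (trans (cong U (punchIn-before a 1+a≡i)) Ua≡Ui))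
      where
        punchIn-before : ∀ a → suc a ≡ i → punchIn i a ≡ inject₁ a
        punchIn-before a 1+a≡i = trans (cong (λ x → punchIn x a) (sym 1+a≡i)) (punchIn-suc-self a)

    pivot-min⇒no-predecessor : MinOfFibre U (U i) i → ¬ PredecessorInFibre
    pivot-min⇒no-predecessor (_ , min) (a , 1+a≡i , ha) =
      ℕ.<⇒≱ (subst (λ x → toℕ a <ℕ toℕ x) 1+a≡i ℕ.≤-refl)
            (pivot≤punchIn⇒≤ i a (min (punchIn i a) (U-fibre ha)))

    pivot-domain : ¬ PredecessorInFibre → flat (fs h) (inject₁ (U i)) ≡ i
    pivot-domain ¬pred =
      trans (flat-h _) (trans (cong (pinch i) (flat-minOfFibre (mono u) pivot-min)) (pinch-inject₁-self i))
      where
        pivot-min : MinOfFibre U (U i) i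
        pivot-min = no-predecessor⇒pivot-min ¬pred

    pivot-sing : Dec PredecessorInFibre → Hom (A.r i) (Y.s (U i))
    pivot-sing (yes (a , 1+a≡i , ha)) = cast (cong A.r 1+a≡i) (cong Y.s ha) (sing h a ∘ A.bwd a)
    pivot-sing (no ¬pred)             =
      Y.fwd (U i) ∘ cast (cong A.r (pivot-domain ¬pred)) refl (reg h (inject₁ (U i)))

    ext-sing : (j′ : Fin (suc n)) → Hom (A′.s j′) (Y.s (U j′))
    ext-sing j′ with i ≟ j′
    ... | yes refl = cast (sym (s-pivot A i)) refl (pivot-sing predecessorInFibre?)
    ... | no  i≢j′ = cast (trans (sym (s-punchIn A i (punchOut i≢j′))) (cong A′.s (punchIn-punchOut i≢j′)))
                          (cong Y.s (trans (h-factors _) (cong U (punchIn-punchOut i≢j′))))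
                          (sing h (punchOut i≢j′))

    ext-sing-pivot : ext-sing i ≈ pivot-sing predecessorInFibre?
    ext-sing-pivot with i ≟ i
    ... | yes refl = cast-≈ _ _ _
    ... | no  i≢i  = ⊥-elim (i≢i refl)

    ext-sing-punchIn : ∀ j → ext-sing (punchIn i j) ≈ sing h j
    ext-sing-punchIn j with i ≟ punchIn i j
    ... | yes i≡j′ = ⊥-elim (punchInᵢ≢i i j (sym i≡j′))
    ... | no  i≢j′ = trans (cast-≈ _ _ _)
                           (cong (λ x → arrow (sing h x)) (trans (punchOut-cong i refl) (punchOut-punchIn i)))

    ext-sing-fwd-punchIn : ∀ j → ext-sing (punchIn i j) ∘ A′.fwd (punchIn i j) ≈ sing h j ∘ A.fwd j
    ext-sing-fwd-punchIn j = ∘-resp-≈ (ext-sing-punchIn j) (fwd-punchIn A i j)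

    ext-sing-bwd-punchIn : ∀ j → ext-sing (punchIn i j) ∘ A′.bwd (punchIn i j) ≈ sing h j ∘ A.bwd j
    ext-sing-bwd-punchIn j = ∘-resp-≈ (ext-sing-punchIn j) (bwd-punchIn A i j)

    ext-sing-fwd-pivot : ext-sing i ∘ A′.fwd i ≈ pivot-sing predecessorInFibre?
    ext-sing-fwd-pivot = trans (∘-idʳ-≈ _ (fwd-pivot A i)) ext-sing-pivot

    ext-sing-bwd-pivot : ext-sing i ∘ A′.bwd i ≈ pivot-sing predecessorInFibre?
    ext-sing-bwd-pivot = trans (∘-idʳ-≈ _ (bwd-pivot A i)) ext-sing-pivot

    pivot-sing-min : (d : Dec PredecessorInFibre) → MinOfFibre U (U i) i →
                     pivot-sing d ≈ Y.fwd (U i) ∘ ext-reg (inject₁ (U i))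
    pivot-sing-min (yes pred) min = ⊥-elim (pivot-min⇒no-predecessor min pred)
    pivot-sing-min (no ¬pred) min = ∘-resp-≈ refl (trans (cast-≈ _ _ _) (sym (ext-reg-≈ _)))

    ext-sing-min : ∀ {k j′} → PunchInView i j′ → MinOfFibre U k j′ →
                   ext-sing j′ ∘ A′.fwd j′ ≅ Y.fwd k ∘ ext-reg (inject₁ k)
    ext-sing-min {k} (punched j) min = begin
      ext-sing (punchIn i j) ∘ A′.fwd (punchIn i j)  ≅⟨ ≈⇒≅ (ext-sing-fwd-punchIn j) ⟩
      sing h j ∘ A.fwd j                             ≅⟨ cond-min h (h-minOfFibre min) ⟩
      Y.fwd k ∘ reg h (inject₁ k)                    ≅⟨ ≈⇒≅ (∘-resp-≈ refl (sym (ext-reg-≈ _))) ⟩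
      Y.fwd k ∘ ext-reg (inject₁ k)                  ∎
    ext-sing-min pivot min@(refl , _) = ≈⇒≅ (trans ext-sing-fwd-pivot (pivot-sing-min predecessorInFibre? min))

    pivot-sing-max : (d : Dec PredecessorInFibre) → MaxOfFibre U (U i) i →
                     pivot-sing d ≅ Y.bwd (U i) ∘ ext-reg (suc (U i))
    pivot-sing-max (yes (a , 1+a≡i , ha)) (_ , max) = begin
      pivot-sing (yes (a , 1+a≡i , ha))  ≅⟨ ≈⇒≅ (cast-≈ _ _ _) ⟩
      sing h a ∘ A.bwd a                 ≅⟨ cond-max h (ha , a-max) ⟩
      Y.bwd (U i) ∘ reg h (suc (U i))    ≅⟨ ≈⇒≅ (∘-resp-≈ refl (sym (ext-reg-≈ _))) ⟩
      Y.bwd (U i) ∘ ext-reg (suc (U i))  ∎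
      where
        a-max : ∀ j → fs h j ≡ U i → j ≤ a
        a-max j hj≡Ui = s≤s⁻¹ (subst (λ x → toℕ j <ℕ toℕ x) (sym 1+a≡i)
                          (punchIn≤pivot⇒< i j (max (punchIn i j) (U-fibre hj≡Ui))))
    pivot-sing-max (no ¬pred) (_ , max) = begin
      pivot-sing (no ¬pred)                ≅⟨ ≈⇒≅ (∘-resp-≈ refl (cast-≈ _ _ _)) ⟩
      Y.fwd (U i) ∘ reg h (inject₁ (U i))  ≅⟨ proj₂ (cond h (U i)) fibre-empty ⟩
      Y.bwd (U i) ∘ reg h (suc (U i))      ≅⟨ ≈⇒≅ (∘-resp-≈ refl (sym (ext-reg-≈ _))) ⟩
      Y.bwd (U i) ∘ ext-reg (suc (U i))    ∎
      where
        fibre-empty : ∀ j → fs h j ≢ U i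
        fibre-empty j hj≡Ui = punchInᵢ≢i i j (≤-antisym (max _ (U-fibre hj≡Ui))
                                                      (proj₂ (no-predecessor⇒pivot-min ¬pred) _ (U-fibre hj≡Ui)))

    ext-sing-max : ∀ {k j′} → PunchInView i j′ → MaxOfFibre U k j′ →
                   ext-sing j′ ∘ A′.bwd j′ ≅ Y.bwd k ∘ ext-reg (suc k)
    ext-sing-max {k} (punched j) max = begin
      ext-sing (punchIn i j) ∘ A′.bwd (punchIn i j)  ≅⟨ ≈⇒≅ (ext-sing-bwd-punchIn j) ⟩
      sing h j ∘ A.bwd j                             ≅⟨ cond-max h (h-maxOfFibre max) ⟩
      Y.bwd k ∘ reg h (suc k)                        ≅⟨ ≈⇒≅ (∘-resp-≈ refl (sym (ext-reg-≈ _))) ⟩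
      Y.bwd k ∘ ext-reg (suc k)                      ∎
    ext-sing-max pivot max@(refl , _) = begin
      ext-sing i ∘ A′.bwd i              ≅⟨ ≈⇒≅ ext-sing-bwd-pivot ⟩
      pivot-sing predecessorInFibre?     ≅⟨ pivot-sing-max predecessorInFibre? max ⟩
      Y.bwd (U i) ∘ ext-reg (suc (U i))  ∎

    predecessor-pivot-sing : (d : Dec PredecessorInFibre) {a : Fin n} → suc a ≡ i → fs h a ≡ U i →
                             sing h a ∘ A.bwd a ≈ pivot-sing d
    predecessor-pivot-sing (yes (a′ , 1+a′≡i , _)) 1+a≡i _ =
      trans (cong (λ x → arrow (sing h x ∘ A.bwd x)) (suc-injective (trans 1+a≡i (sym 1+a′≡i))))
            (sym (cast-≈ _ _ _))
    predecessor-pivot-sing (no ¬pred) 1+a≡i ha = ⊥-elim (¬pred (_ , 1+a≡i , ha))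

    pivot-sing-successor : (d : Dec PredecessorInFibre) {b : Fin n} → inject₁ b ≡ i → fs h b ≡ U i →
                           pivot-sing d ≅ sing h b ∘ A.fwd b
    pivot-sing-successor (yes (a , 1+a≡i , ha)) {b} b≡i hb = begin
      pivot-sing (yes (a , 1+a≡i , ha))  ≅⟨ ≈⇒≅ (cast-≈ _ _ _) ⟩
      sing h a ∘ A.bwd a                 ≅⟨ cond-step h b≡1+a (trans ha (sym hb)) ⟩
      sing h b ∘ A.fwd b                 ∎
      where
        b≡1+a : toℕ b ≡ suc (toℕ a)
        b≡1+a = trans (sym (toℕ-inject₁ b)) (trans (cong toℕ b≡i) (cong toℕ (sym 1+a≡i)))
    pivot-sing-successor (no ¬pred) {b} b≡i hb = begin
      pivot-sing (no ¬pred)                ≅⟨ ≈⇒≅ (∘-resp-≈ refl (cast-≈ _ _ _)) ⟩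
      Y.fwd (U i) ∘ reg h (inject₁ (U i))  ≅⟨ cond-min h (hb , b-min) ⟨
      sing h b ∘ A.fwd b                   ∎
      where
        b-min : ∀ j → fs h j ≡ U i → b ≤ j
        b-min j hj≡Ui = subst (_≤ℕ toℕ j) (trans (cong toℕ (sym b≡i)) (toℕ-inject₁ b))
          (pivot≤punchIn⇒≤ i j (proj₂ (no-predecessor⇒pivot-min ¬pred) (punchIn i j) (U-fibre hj≡Ui)))

    ext-sing-step : ∀ {j j′} → PunchInView i j → PunchInView i j′ →
                    toℕ j′ ≡ suc (toℕ j) → U j ≡ U j′ → ext-sing j ∘ A′.bwd j ≅ ext-sing j′ ∘ A′.fwd j′
    ext-sing-step (punched a) (punched b) b≡1+a Ua≡Ub = begin
      ext-sing (punchIn i a) ∘ A′.bwd (punchIn i a)  ≅⟨ ≈⇒≅ (ext-sing-bwd-punchIn a) ⟩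
      sing h a ∘ A.bwd a                             ≅⟨ cond-step h (punchIn-consecutive i a b b≡1+a) ha≡hb ⟩
      sing h b ∘ A.fwd b                             ≅⟨ ≈⇒≅ (ext-sing-fwd-punchIn b) ⟨
      ext-sing (punchIn i b) ∘ A′.fwd (punchIn i b)  ∎
      where
        ha≡hb : fs h a ≡ fs h b
        ha≡hb = trans (h-factors a) (trans Ua≡Ub (sym (h-factors b)))
    ext-sing-step pivot pivot i≡1+i _ = ⊥-elim (ℕ.1+n≢n (sym i≡1+i))
    ext-sing-step (punched a) pivot i≡1+a Ua≡Ui = begin
      ext-sing (punchIn i a) ∘ A′.bwd (punchIn i a)  ≅⟨ ≈⇒≅ (ext-sing-bwd-punchIn a) ⟩
      sing h a ∘ A.bwd a                             ≅⟨ ≈⇒≅ (predecessor-pivot-sing predecessorInFibre? 1+a≡i ha≡Ui) ⟩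
      pivot-sing predecessorInFibre?                 ≅⟨ ≈⇒≅ ext-sing-fwd-pivot ⟨
      ext-sing i ∘ A′.fwd i                          ∎
      where
        1+a≡i : suc a ≡ i
        1+a≡i = toℕ-just-below⇒suc≡pivot i a i≡1+a
        ha≡Ui : fs h a ≡ U i
        ha≡Ui = trans (h-factors a) Ua≡Ui
    ext-sing-step pivot (punched b) b≡1+i Ui≡Ub = begin
      ext-sing i ∘ A′.bwd i                          ≅⟨ ≈⇒≅ ext-sing-bwd-pivot ⟩
      pivot-sing predecessorInFibre?                 ≅⟨ pivot-sing-successor predecessorInFibre? b≡i hb≡Ui ⟩
      sing h b ∘ A.fwd b                             ≅⟨ ≈⇒≅ (ext-sing-fwd-punchIn b) ⟨
      ext-sing (punchIn i b) ∘ A′.fwd (punchIn i b)  ∎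
      where
        b≡i : inject₁ b ≡ i
        b≡i = toℕ-just-above⇒inject₁≡pivot i b b≡1+i
        hb≡Ui : fs h b ≡ U i
        hb≡Ui = trans (h-factors b) (sym Ui≡Ub)

    ext-reg-empty : ∀ k → (∀ j′ → U j′ ≢ k) → Y.fwd k ∘ ext-reg (inject₁ k) ≅ Y.bwd k ∘ ext-reg (suc k)
    ext-reg-empty k empty = begin
      Y.fwd k ∘ ext-reg (inject₁ k)  ≅⟨ ≈⇒≅ (∘-resp-≈ refl (ext-reg-≈ _)) ⟩
      Y.fwd k ∘ reg h (inject₁ k)    ≅⟨ proj₂ (cond h k) (λ j hj≡k → empty (punchIn i j) (U-fibre hj≡k)) ⟩
      Y.bwd k ∘ reg h (suc k)        ≅⟨ ≈⇒≅ (∘-resp-≈ refl (ext-reg-≈ _)) ⟨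
      Y.bwd k ∘ ext-reg (suc k)      ∎

    extension : ZigzagMap C A′ Y
    extension = record
      { fs      = U
      ; fs-mono = mono u
      ; reg     = ext-reg
      ; sing    = ext-sing
      ; cond    = zigzagCond-local {X = A′} U (mono u) ext-reg ext-sing
                    (ext-sing-min (punchIn-view i _)) (ext-sing-max (punchIn-view i _))
                    (ext-sing-step (punchIn-view i _) (punchIn-view i _)) ext-reg-empty
      }

    extension-unique : (w : ZigzagMap C A′ Y) → fs w ≗ U → (∀ k → reg w k ≈ reg h k) →
                       (∀ j → sing w (punchIn i j) ≈ sing h j) → _≈Z_ C w extension
    extension-unique w w≗U reg-w sing-w =
      w≗U , (λ j′ → sing-unique (punchIn-view i j′)) , λ k → ≈⇒≅ (trans (reg-w k) (sym (ext-reg-≈ k)))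
      where
        pivot-unique : (d : Dec PredecessorInFibre) → sing w i ≅ pivot-sing d
        pivot-unique (yes (a , 1+a≡i , ha)) = begin
          sing w i                                     ≅⟨ ≈⇒≅ (∘-idʳ-≈ _ (fwd-pivot A i)) ⟨
          sing w i ∘ A′.fwd i                          ≅⟨ cond-step w (suc≡pivot⇒toℕ-just-below a 1+a≡i) wa≡wi ⟨
          sing w (punchIn i a) ∘ A′.bwd (punchIn i a)  ≅⟨ ≈⇒≅ (∘-resp-≈ (sing-w a) (bwd-punchIn A i a)) ⟩
          sing h a ∘ A.bwd a                           ≅⟨ ≈⇒≅ (cast-≈ _ _ _) ⟨
          pivot-sing (yes (a , 1+a≡i , ha))            ∎
          where
            wa≡wi : fs w (punchIn i a) ≡ fs w i
            wa≡wi = trans (w≗U _) (U-fibre (trans ha (sym (w≗U i))))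
        pivot-unique (no ¬pred) = begin
          sing w i                             ≅⟨ ≈⇒≅ (∘-idʳ-≈ _ (fwd-pivot A i)) ⟨
          sing w i ∘ A′.fwd i                  ≅⟨ cond-min w w-min ⟩
          Y.fwd (U i) ∘ reg w (inject₁ (U i))  ≅⟨ ≈⇒≅ (∘-resp-≈ refl (trans (reg-w _) (sym (cast-≈ _ _ _)))) ⟩
          pivot-sing (no ¬pred)                ∎
          where
            w-min : MinOfFibre (fs w) (U i) i
            w-min = minOfFibre-resp (λ j → sym (w≗U j)) (no-predecessor⇒pivot-min ¬pred)

        sing-unique : ∀ {j′} → PunchInView i j′ → sing w j′ ≅ ext-sing j′
        sing-unique (punched j) = ≈⇒≅ (trans (sing-w j) (sym (ext-sing-punchIn j)))
        sing-unique pivot       = H.trans (pivot-unique predecessorInFibre?) (≈⇒≅ (sym ext-sing-pivot))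

  module FaceFactorisation {n l} (A : Zigzag C n) (i : Fin (suc n)) (f : ZigzagMap C A (insertId C A i))
    (f-face : fs f ≗ punchIn i)
    (f-reg : ∀ k → reg f k ≅ id {Zigzag.r (insertId C A i) k})
    (f-sing : ∀ j → sing f j ≅ id {Zigzag.s A j})
    {Y : Zigzag C l} (h : ZigzagMap C A Y) (u : Δ₊Hom (suc n) l)
    (h-factors : fs h ≗ λ j → fun u (fs f j)) where
    private
      module A = Zigzag A
      module A′ = Zigzag (insertId C A i)
    open Extension A i h u (λ j → trans (h-factors j) (cong (fun u) (f-face j))) public

    f-reg-≈ : ∀ x → reg f x ≈ id {A′.r x}
    f-reg-≈ x = ≅⇒≈ (cong A.r (trans (flat-cong f-face x) (flat-punchIn i x))) refl (f-reg x)

    f-sing-≈ : ∀ j → sing f j ≈ id {A.s j}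
    f-sing-≈ j = ≅⇒≈ refl (trans (cong A′.s (f-face j)) (s-punchIn A i j)) (f-sing j)

    extension∘f : CompEq C extension f h
    extension∘f =
        (λ j → sym (h-factors j))
      , (λ j → ≈⇒≅ (trans (∘-idʳ-≈ _ (f-sing-≈ j))
                          (trans (cong (λ x → arrow (ext-sing x)) (f-face j)) (ext-sing-punchIn j))))
      , (λ k → ≈⇒≅ (trans (∘-idʳ-≈ _ (f-reg-≈ _)) (ext-reg-≈ k)))

    factorisation-unique : ∀ w → CompEq C w f h → fs w ≗ fun u → _≈Z_ C w extension
    factorisation-unique w (w∘f-s , w∘f-sing , w∘f-reg) w≗u = extension-unique w w≗u w-reg w-sing
      where
        w-reg : ∀ k → reg w k ≈ reg h k
        w-reg k = ≅⇒≈ (cong A.r (trans (cong (pinch i) (flat-cong w≗u k)) (sym (flat-h k)))) refl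
                      (H.trans (≈⇒≅ (sym (∘-idʳ-≈ _ (f-reg-≈ _)))) (w∘f-reg k))

        w-sing : ∀ j → sing w (punchIn i j) ≈ sing h j
        w-sing j = trans (cong (λ x → arrow (sing w x)) (sym (f-face j)))
          (≅⇒≈ (trans (cong A′.s (f-face j)) (s-punchIn A i j)) (cong (Zigzag.s Y) (w∘f-s j))
               (H.trans (≈⇒≅ (sym (∘-idʳ-≈ _ (f-sing-≈ j)))) (w∘f-sing j)))

lemma3p2 : ∀ {o ℓ : Level} (C : Category o ℓ) (n : ℕ) (A : Zigzag C n) (i : Fin (suc n))
           (f : ZigzagMap C A (insertId C A i)) →
           (fs f ≗ punchIn i) →
           (∀ k → reg f k ≅ Category.id C {Zigzag.r (insertId C A i) k}) →
           (∀ j → sing f j ≅ Category.id C {Zigzag.s A j}) →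
           IsCocartesian C f
lemma3p2 C n A i f f-face f-reg f-sing Y h u h-factors =
  extension , (extension∘f , λ _ → refl) , factorisation-unique
  where open FaceFactorisation C A i f f-face f-reg f-sing h u h-factors
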